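{- Let $k$ be a positive integer. If $4k+1$ is prime, then $4k+1$ divides $k^k-1$. -}

module Defs where

-- Write p = 4k + 1. Multiplying each odd number 2m + 1 < 2k by 4k ≡ −1 (mod p) gives
-- p − (2m + 1), so (4k)^k times the product of the odd numbers below 2k is congruent to
-- the product of the even numbers 2k + 2, …, 4k (Gauss's pairing). Multiplying by the
-- product of the evens 2, …, 2k, both sides become the product E of all evens up to 4k,
-- because E = 2^(2k) (2k)! = 4^k · (odds below 2k) · (evens up to 2k). Hence
-- k^k · E ≡ E (mod p), and E is prime to p since all its factors lie strictly between
-- 0 and p.
module Submission where

open import Defs
open import Data.Nat using (ℕ; _+_; _*_; _∸_; _^_; _≥_)
open import Data.Nat.Divisibility using (_∣_)
open import Data.Nat.Primality using (Prime)

open import Data.List using ([]; _∷_)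
open import Data.Nat using (zero; suc; _<_; NonZero; _%_; _/_; z<s)
open import Data.Nat.DivMod using (m≡m%n+[m/n]*n; [m+kn]%n≡m%n; %-distribˡ-*)
open import Data.Nat.Divisibility using (_∤_; divides; ∣1⇒≡1; >⇒∤)
open import Data.Nat.Primality using (¬prime[1]; euclidsLemma; prime⇒nonZero)
open import Data.Nat.Properties
  using ( +-suc; +-identityʳ; n<1+n; +-mono-≤; *-comm; *-assoc; *-identityʳ; *-distribˡ-∸
        ; *-distribʳ-∸; [m+n]∸[m+o]≡n∸o; m∸n+n≡m; m<n⇒m<1+n; m<m+n
        ; ^-distribˡ-+-*; module ≤-Reasoning)
open import Data.Nat.Tactic.RingSolver using (solve-∀; solve)
open import Data.Sum using ([_,_]′; fromInj₂)
open import Function using (_∘_)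
open import Relation.Binary.Bundles using (Setoid)
import Relation.Binary.Construct.On as On
open import Relation.Binary.PropositionalEquality
  using (_≡_; refl; sym; trans; cong; cong₂; subst; setoid; module ≡-Reasoning)
open import Relation.Nullary using (contradiction)

private
  variable
    a b c i k n : ℕ
    f g : ℕ → ℕ

∏ : ℕ → (ℕ → ℕ) → ℕ
∏ zero    f = 1
∏ (suc n) f = ∏ n f * f n

∏-suc : ∀ n → ∏ (suc n) f ≡ f 0 * ∏ n (f ∘ suc)
∏-suc zero = *-comm 1 _
∏-suc {f} (suc n) = begin
  ∏ n f * f n * f (suc n)            ≡⟨ cong (_* f (suc n)) (∏-suc n) ⟩
  f 0 * ∏ n (f ∘ suc) * f (suc n)    ≡⟨ *-assoc (f 0) _ _ ⟩
  f 0 * (∏ n (f ∘ suc) * f (suc n))  ∎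
  where open ≡-Reasoning

∏-cong : ∀ n → (∀ i → f i ≡ g i) → ∏ n f ≡ ∏ n g
∏-cong zero    f≡g = refl
∏-cong (suc n) f≡g = cong₂ _*_ (∏-cong n f≡g) (f≡g n)

∏-const : ∀ n c → ∏ n (λ _ → c) ≡ c ^ n
∏-const zero    c = refl
∏-const (suc n) c = trans (cong (_* c) (∏-const n c)) (*-comm (c ^ n) c)

∏-distrib-* : ∀ n → ∏ n (λ i → f i * g i) ≡ ∏ n f * ∏ n g
∏-distrib-* zero = refl
∏-distrib-* {f} {g} (suc n) = begin
  ∏ n (λ i → f i * g i) * (f n * g n)  ≡⟨ cong (_* (f n * g n)) (∏-distrib-* n) ⟩
  ∏ n f * ∏ n g * (f n * g n)          ≡⟨ interchange (∏ n f) (∏ n g) (f n) (g n) ⟩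
  ∏ n f * f n * (∏ n g * g n)          ∎
  where
  open ≡-Reasoning
  interchange : ∀ w x y z → w * x * (y * z) ≡ w * y * (x * z)
  interchange = solve-∀

∏-+ : ∀ m n → ∏ (m + n) f ≡ ∏ m f * ∏ n (λ i → f (m + i))
∏-+ {f} m zero = trans (cong (λ l → ∏ l f) (+-identityʳ m)) (sym (*-identityʳ (∏ m f)))
∏-+ {f} m (suc n) = begin
  ∏ (m + suc n) f                                    ≡⟨ cong (λ l → ∏ l f) (+-suc m n) ⟩
  ∏ (m + n) f * f (m + n)                            ≡⟨ cong (_* f (m + n)) (∏-+ m n) ⟩
  ∏ m f * ∏ n (λ i → f (m + i)) * f (m + n)          ≡⟨ *-assoc (∏ m f) _ _ ⟩
  ∏ m f * (∏ n (λ i → f (m + i)) * f (m + n))        ∎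
  where open ≡-Reasoning

∏-reverse : ∀ n → ∏ n (λ i → f (n ∸ suc i)) ≡ ∏ n f
∏-reverse zero = refl
∏-reverse {f} (suc n) = begin
  ∏ (suc n) (λ i → f (n ∸ i))         ≡⟨ ∏-suc n ⟩
  f n * ∏ n (λ i → f (n ∸ suc i))     ≡⟨ cong (f n *_) (∏-reverse n) ⟩
  f n * ∏ n f                         ≡⟨ *-comm (f n) _ ⟩
  ∏ n f * f n                         ∎
  where open ≡-Reasoning

∏-interleave : ∀ n → ∏ (n + n) f ≡ ∏ n (λ i → f (i + i)) * ∏ n (λ i → f (suc (i + i)))
∏-interleave zero = refl
∏-interleave {f} (suc n) = begin
  ∏ (suc n + suc n) f                        ≡⟨ cong (λ l → ∏ (suc l) f) (+-suc n n) ⟩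
  ∏ (n + n) f * f (n + n) * f (suc (n + n))  ≡⟨ cong (λ x → x * f (n + n) * f (suc (n + n)))
                                                     (∏-interleave n) ⟩
  E * O * f (n + n) * f (suc (n + n))        ≡⟨ interchange E O (f (n + n)) (f (suc (n + n))) ⟩
  E * f (n + n) * (O * f (suc (n + n)))      ∎
  where
  open ≡-Reasoning
  E = ∏ n (λ i → f (i + i))
  O = ∏ n (λ i → f (suc (i + i)))
  interchange : ∀ w x y z → w * x * y * z ≡ w * y * (x * z)
  interchange = solve-∀

∏-∤ : ∀ {p} → Prime p → (∀ {i} → i < n → p ∤ f i) → p ∤ ∏ n f
∏-∤ {zero}  p-prime _   p∣1 = ¬prime[1] (subst Prime (∣1⇒≡1 p∣1) p-prime)
∏-∤ {suc n} p-prime p∤f =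
  [ ∏-∤ p-prime (p∤f ∘ m<n⇒m<1+n) , p∤f (n<1+n n) ]′ ∘ euclidsLemma _ _ p-prime

module Modulo (p : ℕ) .{{_ : NonZero p}} where

  infix 4 _≈_
  _≈_ : ℕ → ℕ → Set
  a ≈ b = a % p ≡ b % p

  ≈-setoid : Setoid _ _
  ≈-setoid = On.setoid (setoid ℕ) (_% p)

  *-congₘ : ∀ {a b c d} → a ≈ b → c ≈ d → a * c ≈ b * d
  *-congₘ {a} {b} {c} {d} a≈b c≈d = begin
    (a * c) % p              ≡⟨ %-distribˡ-* a c p ⟩
    (a % p * (c % p)) % p    ≡⟨ cong₂ (λ x y → (x * y) % p) a≈b c≈d ⟩
    (b % p * (d % p)) % p    ≡⟨ %-distribˡ-* b d p ⟨
    (b * d) % p              ∎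
    where open ≡-Reasoning

  ∏-congₘ : ∀ n → (∀ {i} → i < n → f i ≈ g i) → ∏ n f ≈ ∏ n g
  ∏-congₘ zero    f≈g = refl
  ∏-congₘ (suc n) f≈g = *-congₘ (∏-congₘ n (f≈g ∘ m<n⇒m<1+n)) (f≈g (n<1+n n))

  ≈⇒∣∸ : a ≈ b → p ∣ a ∸ b
  ≈⇒∣∸ {a} {b} a≈b = divides (a / p ∸ b / p) (begin
    a ∸ b                                ≡⟨ cong₂ _∸_ (m≡m%n+[m/n]*n a p) (m≡m%n+[m/n]*n b p) ⟩
    (a % p + qa * p) ∸ (b % p + qb * p)  ≡⟨ cong (λ r → (a % p + qa * p) ∸ (r + qb * p)) a≈b ⟨
    (a % p + qa * p) ∸ (a % p + qb * p)  ≡⟨ [m+n]∸[m+o]≡n∸o (a % p) _ _ ⟩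
    qa * p ∸ qb * p                      ≡⟨ *-distribʳ-∸ p qa qb ⟨
    (qa ∸ qb) * p                        ∎)
    where
    open ≡-Reasoning
    qa = a / p
    qb = b / p

  *-cancelˡ-∣∸ : Prime p → p ∤ c → c * a ≈ c * b → p ∣ a ∸ b
  *-cancelˡ-∣∸ {c} {a} {b} p-prime p∤c ca≈cb =
    fromInj₂ (λ p∣c → contradiction p∣c p∤c) (euclidsLemma c (a ∸ b) p-prime p∣c[a∸b])
    where
    p∣c[a∸b] : p ∣ c * (a ∸ b)
    p∣c[a∸b] = subst (p ∣_) (sym (*-distribˡ-∸ c a b)) (≈⇒∣∸ ca≈cb)

odd even : ℕ → ℕ
odd  i = 1 + (i + i)
even i = 2 + (i + i)

∏-even : ∀ n → ∏ (n + n) even ≡ 2 ^ (n + n) * (∏ n odd * ∏ n even)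
∏-even n = begin
  ∏ (n + n) even                       ≡⟨ ∏-cong (n + n) even≡2*suc ⟩
  ∏ (n + n) (λ i → 2 * suc i)          ≡⟨ ∏-distrib-* (n + n) ⟩
  ∏ (n + n) (λ _ → 2) * ∏ (n + n) suc  ≡⟨ cong₂ _*_ (∏-const (n + n) 2) (∏-interleave n) ⟩
  2 ^ (n + n) * (∏ n odd * ∏ n even)   ∎
  where
  open ≡-Reasoning
  even≡2*suc : ∀ i → 2 + (i + i) ≡ 2 * suc i
  even≡2*suc = solve-∀

^-distribʳ-* : ∀ a b n → (a * b) ^ n ≡ a ^ n * b ^ n
^-distribʳ-* a b n = begin
  (a * b) ^ n                              ≡⟨ ∏-const n (a * b) ⟨
  ∏ n (λ _ → a * b)                        ≡⟨ ∏-distrib-* n ⟩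
  ∏ n (λ _ → a) * ∏ n (λ _ → b)            ≡⟨ cong₂ _*_ (∏-const n a) (∏-const n b) ⟩
  a ^ n * b ^ n                            ∎
  where open ≡-Reasoning

[4*k]^n≡2^[n+n]*k^n : ∀ k n → (4 * k) ^ n ≡ 2 ^ (n + n) * k ^ n
[4*k]^n≡2^[n+n]*k^n k n = begin
  (4 * k) ^ n          ≡⟨ ^-distribʳ-* 4 k n ⟩
  4 ^ n * k ^ n        ≡⟨ cong (_* k ^ n) (^-distribʳ-* 2 2 n) ⟩
  2 ^ n * 2 ^ n * k ^ n ≡⟨ cong (_* k ^ n) (^-distribˡ-+-* 2 n n) ⟨
  2 ^ (n + n) * k ^ n  ∎
  where open ≡-Reasoning

4k*odd≡even+[m+m]*p : ∀ m i k → suc (m + i) ≡ k → 4 * k * odd m ≡ even (k + i) + (m + m) * (4 * k + 1)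
4k*odd≡even+[m+m]*p m i _ refl = identity m i
  where
  identity : ∀ m i → let k = suc (m + i) in
             4 * k * (1 + (m + m)) ≡ 2 + ((k + i) + (k + i)) + (m + m) * (4 * k + 1)
  identity = solve-∀

even<4k+1 : i < k + k → even i < 4 * k + 1
even<4k+1 {i} {k} i<2k = begin-strict
  even i                  ≡⟨ cong suc (+-suc i i) ⟨
  suc i + suc i           ≤⟨ +-mono-≤ i<2k i<2k ⟩
  (k + k) + (k + k)       ≡⟨ solve (k ∷ []) ⟩
  4 * k                   <⟨ m<m+n (4 * k) z<s ⟩
  4 * k + 1               ∎
  where open ≤-Reasoning

module _ (k : ℕ) .{{_ : NonZero (4 * k + 1)}} where

  open Modulo (4 * k + 1)
  open import Relation.Binary.Reasoning.Setoid ≈-setoid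

  4k*odd≈even : i < k → 4 * k * odd (k ∸ suc i) ≈ even (k + i)
  4k*odd≈even {i} i<k = begin
    4 * k * odd m                    ≡⟨ 4k*odd≡even+[m+m]*p m i k 1+m+i≡k ⟩
    even (k + i) + (m + m) * p       ≈⟨ [m+kn]%n≡m%n (even (k + i)) (m + m) p ⟩
    even (k + i)                     ∎
    where
    p = 4 * k + 1
    m = k ∸ suc i
    1+m+i≡k : suc (m + i) ≡ k
    1+m+i≡k = trans (sym (+-suc m i)) (m∸n+n≡m i<k)

  gauss-pairing : (4 * k) ^ k * ∏ k odd ≈ ∏ k (λ i → even (k + i))
  gauss-pairing = begin
    (4 * k) ^ k * ∏ k odd                  ≡⟨ cong ((4 * k) ^ k *_) (∏-reverse k) ⟨
    (4 * k) ^ k * ∏ k reversed             ≡⟨ cong (_* ∏ k reversed) (∏-const k (4 * k)) ⟨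
    ∏ k (λ _ → 4 * k) * ∏ k reversed       ≡⟨ ∏-distrib-* k ⟨
    ∏ k (λ i → 4 * k * odd (k ∸ suc i))    ≈⟨ ∏-congₘ k 4k*odd≈even ⟩
    ∏ k (λ i → even (k + i))               ∎
    where
    reversed : ℕ → ℕ
    reversed i = odd (k ∸ suc i)

  ∏even*k^k≈∏even : ∏ (k + k) even * k ^ k ≈ ∏ (k + k) even * 1
  ∏even*k^k≈∏even = begin
    ∏ (k + k) even * k ^ k                         ≡⟨ cong (_* k ^ k) (∏-even k) ⟩
    2 ^ (k + k) * (∏ k odd * ∏ k even) * k ^ k     ≡⟨ rearrange (2 ^ (k + k)) (∏ k odd) _ (k ^ k) ⟩
    2 ^ (k + k) * k ^ k * ∏ k odd * ∏ k even       ≡⟨ cong (λ x → x * ∏ k odd * ∏ k even)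
                                                          ([4*k]^n≡2^[n+n]*k^n k k) ⟨
    (4 * k) ^ k * ∏ k odd * ∏ k even               ≈⟨ *-congₘ gauss-pairing refl ⟩
    ∏ k (λ i → even (k + i)) * ∏ k even            ≡⟨ *-comm _ (∏ k even) ⟩
    ∏ k even * ∏ k (λ i → even (k + i))            ≡⟨ ∏-+ k k ⟨
    ∏ (k + k) even                                 ≡⟨ *-identityʳ _ ⟨
    ∏ (k + k) even * 1                             ∎
    where
    rearrange : ∀ w x y z → w * (x * y) * z ≡ w * z * x * y
    rearrange = solve-∀

proposition3p1 : (k : ℕ) → k ≥ 1 → Prime (4 * k + 1) → (4 * k + 1) ∣ (k ^ k ∸ 1)
proposition3p1 k _ p-prime = *-cancelˡ-∣∸ p-prime p∤∏even (∏even*k^k≈∏even k)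
  where
  instance _ = prime⇒nonZero p-prime
  open Modulo (4 * k + 1)
  p∤∏even : 4 * k + 1 ∤ ∏ (k + k) even
  p∤∏even = ∏-∤ p-prime (>⇒∤ ∘ even<4k+1 {k = k})
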